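{- For every nonnegative integer $n$, let $RR_2(n)$ denote the number of partitions of $n$ into parts greater than $1$ in which any two parts differ by at least $2$, and let $RR_{ -2}(n)$ denote the number of signed partitions of $n$ in which the positive parts differ pairwise by at least $3$, alternate in parity (when listed in increasing order, consecutive positive parts have opposite parity), contain no part equal to $1$, and have odd smallest positive part, and the negative parts are distinct and each at most the number of positive parts. Then $RR_2(n)=RR_{ -2}(n)$ for all $n\ge 0$.
   Context: A partition of an integer $n$ is a finite nonincreasing sequence of positive integers (its parts) summing to $n$. A signed partition of an integer $n$ is a pair $(\pi,\nu)$ of ordinary partitions with $|\pi|-|\nu|=n$, where $|\cdot|$ denotes the sum of parts; the parts of $\pi$ are the positive parts and the parts of $\nu$ are the negative parts (their sizes). -}

module Defs where

open import Data.Nat using (ℕ; _+_; _≤_; _<_; _%_)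
open import Data.Nat.ListAction using (sum)
open import Data.List using (List; []; _∷_; length)
open import Data.List.Relation.Unary.All using (All)
open import Data.List.Relation.Unary.Linked using (Linked)
open import Data.List.Relation.Unary.AllPairs using (AllPairs)
open import Data.Product using (Σ; _×_; _,_)
open import Data.Unit using (⊤)
open import Relation.Binary.PropositionalEquality using (_≡_)

IsPartition : List ℕ → Set
IsPartition p = All (λ a → 1 ≤ a) p × Linked (λ a b → b ≤ a) p

DifferBy : ℕ → List ℕ → Set
DifferBy d p = AllPairs (λ a b → b + d ≤ a) p

OppositeParity : ℕ → ℕ → Set
OppositeParity a b = a % 2 + b % 2 ≡ 1

SmallestOdd : List ℕ → Set
SmallestOdd []           = ⊤
SmallestOdd (x ∷ [])     = x % 2 ≡ 1
SmallestOdd (x ∷ y ∷ r)  = SmallestOdd (y ∷ r)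

RR2 : ℕ → Set
RR2 n = Σ (List ℕ) λ p →
  IsPartition p × sum p ≡ n × All (λ a → 2 ≤ a) p × DifferBy 2 p

RRm2 : ℕ → Set
RRm2 n = Σ (List ℕ × List ℕ) λ where
  (π , ν) → IsPartition π × IsPartition ν × sum π ≡ n + sum ν
          × DifferBy 3 π
          × Linked OppositeParity π
          × All (λ a → 2 ≤ a) π
          × SmallestOdd π
          × AllPairs (λ a b → b < a) ν
          × All (λ b → b ≤ length π) ν

-- A partition a₁ > ⋯ > a_k counted by RR₂(n) is determined by its gaps
-- dᵢ = aᵢ − aᵢ₊₁ − 2 ≥ 0 (with a_{k+1} = 0), and n = Σᵢ i·(2 + dᵢ).  For a signed
-- partition (π, ν) counted by RR₋₂(n) with k positive parts, the conditions on π say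
-- exactly that its differences (again with a_{k+1} = 0) are 3 + 2cᵢ, and ν is an
-- arbitrary subset of {1, …, k}.  Setting dᵢ = 2cᵢ + [i ∉ ν] is a bijection, and position i
-- contributes i·[i ∈ ν] + i·(2 + dᵢ) = i·(3 + 2cᵢ), so that Σπ − Σν = Σᵢ i·(2 + dᵢ).

module Submission where

open import Defs
open import Data.Bool using (Bool; true; false; not)
open import Data.List using (List; []; _∷_; _∷ʳ_; length; map; reverse; zip; unzip)
open import Data.List.Properties
  using (map-∘; map-cong; map-id; map-id-local; map-++; length-map; length-reverse; unfold-reverse;
         reverse-involutive; zip-unzip; unzip-zip)
open import Data.List.Relation.Unary.All as All using (All; []; _∷_)
open import Data.List.Relation.Unary.All.Properties using (map⁺)
open import Data.List.Relation.Unary.AllPairs as AllPairs using (AllPairs; []; _∷_)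
open import Data.List.Relation.Unary.Linked as Linked using (Linked; []; [-]; _∷_)
open import Data.List.Relation.Unary.Linked.Properties using (AllPairs⇒Linked; Linked⇒AllPairs)
open import Data.Nat using (ℕ; zero; suc; _+_; _*_; _∸_; _≤_; _<_; _%_; z≤n; s≤s; _≟_)
open import Data.Nat.DivMod using (m*n%n≡0)
open import Data.Nat.ListAction using (sum)
open import Data.Nat.ListAction.Properties using (sum-++)
open import Data.Nat.Properties
open import Algebra.Properties.CommutativeSemigroup +-commutativeSemigroup using (interchange)
open import Data.Nat.Tactic.RingSolver using (solve-∀)
open import Data.Product using (Σ; _×_; _,_; proj₁; proj₂; map₁; uncurry)
open import Data.Product.Properties using (Σ-≡,≡→≡)
open import Data.Unit using (tt)
open import Function using (_∘_; id)
open import Function.Bundles using (_↔_; _⇔_; mk↔ₛ′; mk⇔; Equivalence)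
open import Function.Properties.Inverse using (↔-trans; ↔-sym)
open import Relation.Binary.Definitions using (Transitive)
open import Relation.Binary.PropositionalEquality
open import Relation.Nullary using (Irrelevant; yes; no; contradiction)

private
  variable
    A B : Set

infixr 2 _×-irrelevant_
_×-irrelevant_ : Irrelevant A → Irrelevant B → Irrelevant (A × B)
(irrA ×-irrelevant irrB) (a , b) (a′ , b′) = cong₂ _,_ (irrA a a′) (irrB b b′)

isPartition-irrelevant : ∀ {p} → Irrelevant (IsPartition p)
isPartition-irrelevant = All.irrelevant ≤-irrelevant ×-irrelevant Linked.irrelevant ≤-irrelevant

differBy-irrelevant : ∀ {d p} → Irrelevant (DifferBy d p)
differBy-irrelevant = AllPairs.irrelevant ≤-irrelevant

smallestOdd-irrelevant : ∀ p → Irrelevant (SmallestOdd p)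
smallestOdd-irrelevant []          tt tt = refl
smallestOdd-irrelevant (_ ∷ [])    = ≡-irrelevant
smallestOdd-irrelevant (_ ∷ y ∷ p) = smallestOdd-irrelevant (y ∷ p)

mk↔-subset : {P : A → Set} {Q : B → Set} →
             (∀ {a} → Irrelevant (P a)) → (∀ {b} → Irrelevant (Q b)) →
             (f : A → B) (g : B → A) →
             (∀ {a} → P a → Q (f a)) → (∀ {b} → Q b → P (g b)) →
             (∀ {a} → P a → g (f a) ≡ a) → (∀ {b} → Q b → f (g b) ≡ b) →
             Σ A P ↔ Σ B Q
mk↔-subset P-irr Q-irr f g f-resp g-resp g∘f f∘g = mk↔ₛ′
  (λ (a , p) → f a , f-resp p)
  (λ (b , q) → g b , g-resp q)
  (λ (b , q) → Σ-≡,≡→≡ (f∘g q , Q-irr _ q))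
  (λ (a , p) → Σ-≡,≡→≡ (g∘f p , P-irr _ p))

map-inverse : {f : A → B} {g : B → A} → (∀ x → g (f x) ≡ x) → ∀ xs → map g (map f xs) ≡ xs
map-inverse g∘f≗id xs = trans (sym (map-∘ xs)) (trans (map-cong g∘f≗id xs) (map-id xs))

unzip≡map-proj : ∀ (xs : List (A × B)) → unzip xs ≡ (map proj₁ xs , map proj₂ xs)
unzip≡map-proj []       = refl
unzip≡map-proj (x ∷ xs) = cong (λ (as , bs) → proj₁ x ∷ as , proj₂ x ∷ bs) (unzip≡map-proj xs)

zip-map-proj : ∀ (xs : List (A × B)) → zip (map proj₁ xs) (map proj₂ xs) ≡ xs
zip-map-proj xs = trans (cong (uncurry zip) (sym (unzip≡map-proj xs))) (zip-unzip xs)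

map-proj-zip : ∀ (as : List A) (bs : List B) → length as ≡ length bs →
               (map proj₁ (zip as bs) , map proj₂ (zip as bs)) ≡ (as , bs)
map-proj-zip as bs eq = trans (sym (unzip≡map-proj (zip as bs))) (unzip-zip as bs eq)

-- Σᵢ i · eᵢ, positions counted from 1 at the head.
weightedSum : List ℕ → ℕ
weightedSum []       = 0
weightedSum (e ∷ es) = sum (e ∷ es) + weightedSum es

module _ {f g h : A → ℕ} (f+g≗h : ∀ x → f x + g x ≡ h x) where

  sum-map-+ : ∀ xs → sum (map f xs) + sum (map g xs) ≡ sum (map h xs)
  sum-map-+ []       = refl
  sum-map-+ (x ∷ xs) = trans (interchange (f x) _ (g x) _) (cong₂ _+_ (f+g≗h x) (sum-map-+ xs))

  weightedSum-map-+ : ∀ xs →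
                      weightedSum (map f xs) + weightedSum (map g xs) ≡ weightedSum (map h xs)
  weightedSum-map-+ []       = refl
  weightedSum-map-+ (x ∷ xs) =
    trans (interchange (sum (map f (x ∷ xs))) _ (sum (map g (x ∷ xs))) _)
          (cong₂ _+_ (sum-map-+ (x ∷ xs)) (weightedSum-map-+ xs))

weightedSum-∷ʳ : ∀ es e → weightedSum (es ∷ʳ e) ≡ e * suc (length es) + weightedSum es
weightedSum-∷ʳ []       e = cong (_+ 0) (trans (+-identityʳ e) (sym (*-identityʳ e)))
weightedSum-∷ʳ (x ∷ es) e = begin
  x + sum (es ∷ʳ e) + weightedSum (es ∷ʳ e)
    ≡⟨ cong₂ (λ s w → x + s + w) (sum-++ es (e ∷ [])) (weightedSum-∷ʳ es e) ⟩
  x + (sum es + (e + 0)) + (e * suc (length es) + weightedSum es)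
    ≡⟨ rearrange x (sum es) e (length es) (weightedSum es) ⟩
  e * suc (suc (length es)) + (x + sum es + weightedSum es) ∎
  where
  open ≡-Reasoning
  rearrange : ∀ x s e l w → x + (s + (e + 0)) + (e * suc l + w) ≡ e * suc (suc l) + (x + s + w)
  rearrange = solve-∀

-- Partitions encoded by their gaps

largestPart : List ℕ → ℕ
largestPart []      = 0
largestPart (a ∷ _) = a

fromGaps : ℕ → List ℕ → List ℕ
fromGaps g []       = []
fromGaps g (d ∷ ds) = largestPart (fromGaps g ds) + (g + d) ∷ fromGaps g ds

toGaps : ℕ → List ℕ → List ℕ
toGaps g []      = []
toGaps g (a ∷ p) = a ∸ largestPart p ∸ g ∷ toGaps g p

length-fromGaps : ∀ g ds → length (fromGaps g ds) ≡ length ds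
length-fromGaps g []       = refl
length-fromGaps g (d ∷ ds) = cong suc (length-fromGaps g ds)

length-toGaps : ∀ g p → length (toGaps g p) ≡ length p
length-toGaps g []      = refl
length-toGaps g (a ∷ p) = cong suc (length-toGaps g p)

toGaps-fromGaps : ∀ g ds → toGaps g (fromGaps g ds) ≡ ds
toGaps-fromGaps g []       = refl
toGaps-fromGaps g (d ∷ ds) = cong₂ _∷_ gap (toGaps-fromGaps g ds)
  where
  open ≡-Reasoning
  t = largestPart (fromGaps g ds)
  gap : t + (g + d) ∸ t ∸ g ≡ d
  gap = begin
    t + (g + d) ∸ t ∸ g ≡⟨ cong (_∸ g) (m+n∸m≡n t (g + d)) ⟩
    g + d ∸ g           ≡⟨ m+n∸m≡n g d ⟩
    d                   ∎

largestPart+g≤ : ∀ {g a p} → All (g ≤_) (a ∷ p) → DifferBy g (a ∷ p) → largestPart p + g ≤ a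
largestPart+g≤ {p = []}    (g≤a ∷ _) _                = g≤a
largestPart+g≤ {p = _ ∷ _} _         ((b+g≤a ∷ _) ∷ _) = b+g≤a

fromGaps-toGaps : ∀ {g} p → All (g ≤_) p → DifferBy g p → fromGaps g (toGaps g p) ≡ p
fromGaps-toGaps         []      _                   _            = refl
fromGaps-toGaps {g = g} (a ∷ p) g≤a∷p@(_ ∷ g≤p) sep@(_ ∷ sep′) = cong₂ _∷_ part ih
  where
  open ≡-Reasoning
  ih = fromGaps-toGaps p g≤p sep′
  t = largestPart p
  t+g≤a : t + g ≤ a
  t+g≤a = largestPart+g≤ g≤a∷p sep
  g≤a∸t : g ≤ a ∸ t
  g≤a∸t = m+n≤o⇒m≤o∸n g (≤-trans (≤-reflexive (+-comm g t)) t+g≤a)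
  part : largestPart (fromGaps g (toGaps g p)) + (g + (a ∸ t ∸ g)) ≡ a
  part = begin
    largestPart (fromGaps g (toGaps g p)) + (g + (a ∸ t ∸ g))
      ≡⟨ cong (λ q → largestPart q + (g + (a ∸ t ∸ g))) ih ⟩
    t + (g + (a ∸ t ∸ g))
      ≡⟨ cong (t +_) (m+[n∸m]≡n g≤a∸t) ⟩
    t + (a ∸ t)
      ≡⟨ m+[n∸m]≡n (m+n≤o⇒m≤o t t+g≤a) ⟩
    a ∎

fromGaps-≥ : ∀ g ds → All (g ≤_) (fromGaps g ds)
fromGaps-≥ g []       = []
fromGaps-≥ g (d ∷ ds) =
  ≤-trans (m≤m+n g d) (m≤n+m (g + d) (largestPart (fromGaps g ds))) ∷ fromGaps-≥ g ds

differBy-trans : ∀ g → Transitive (λ a b → b + g ≤ a)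
differBy-trans g {j = b} b+g≤a c+g≤b = ≤-trans c+g≤b (≤-trans (m≤m+n b g) b+g≤a)

fromGaps-differBy : ∀ g ds → DifferBy g (fromGaps g ds)
fromGaps-differBy g ds = Linked⇒AllPairs (differBy-trans g) (consecutive ds)
  where
  consecutive : ∀ ds → Linked (λ a b → b + g ≤ a) (fromGaps g ds)
  consecutive []               = []
  consecutive (d ∷ [])         = [-]
  consecutive (d ∷ ds@(_ ∷ _)) =
    +-monoʳ-≤ (largestPart (fromGaps g ds)) (m≤m+n g d) ∷ consecutive ds

differBy⇒isPartition : ∀ {g p} → 1 ≤ g → All (g ≤_) p → DifferBy g p → IsPartition p
differBy⇒isPartition 1≤g g≤p sep =
  All.map (≤-trans 1≤g) g≤p , Linked.map (λ {a} {b} → m+n≤o⇒m≤o b) (AllPairs⇒Linked sep)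

largestPart-fromGaps : ∀ g ds → largestPart (fromGaps g ds) ≡ sum (map (g +_) ds)
largestPart-fromGaps g []       = refl
largestPart-fromGaps g (d ∷ ds) =
  trans (cong (_+ (g + d)) (largestPart-fromGaps g ds)) (+-comm _ (g + d))

sum-fromGaps : ∀ g ds → sum (fromGaps g ds) ≡ weightedSum (map (g +_) ds)
sum-fromGaps g []       = refl
sum-fromGaps g (d ∷ ds) = cong₂ _+_ (largestPart-fromGaps g (d ∷ ds)) (sum-fromGaps g ds)

-- Subsets of {1, …, k} as bit lists

toℕ : Bool → ℕ
toℕ false = 0
toℕ true  = 1

-- The head of a bit list of length k is the bit of k.
subsetOf : List Bool → List ℕ
subsetOf []           = []
subsetOf (true  ∷ bs) = suc (length bs) ∷ subsetOf bs
subsetOf (false ∷ bs) = subsetOf bs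

indicator : ℕ → List ℕ → List Bool
indicator zero    _       = []
indicator (suc k) []      = false ∷ indicator k []
indicator (suc k) (v ∷ ν) with v ≟ suc k
... | yes _ = true  ∷ indicator k ν
... | no  _ = false ∷ indicator k (v ∷ ν)

subsetOf-≤ : ∀ bs → All (_≤ length bs) (subsetOf bs)
subsetOf-≤ []           = []
subsetOf-≤ (true  ∷ bs) = ≤-refl ∷ All.map m≤n⇒m≤1+n (subsetOf-≤ bs)
subsetOf-≤ (false ∷ bs) = All.map m≤n⇒m≤1+n (subsetOf-≤ bs)

subsetOf-positive : ∀ bs → All (1 ≤_) (subsetOf bs)
subsetOf-positive []           = []
subsetOf-positive (true  ∷ bs) = s≤s z≤n ∷ subsetOf-positive bs
subsetOf-positive (false ∷ bs) = subsetOf-positive bs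

subsetOf-decreasing : ∀ bs → AllPairs (λ a b → b < a) (subsetOf bs)
subsetOf-decreasing []           = []
subsetOf-decreasing (true  ∷ bs) = All.map s≤s (subsetOf-≤ bs) ∷ subsetOf-decreasing bs
subsetOf-decreasing (false ∷ bs) = subsetOf-decreasing bs

length-indicator : ∀ k ν → length (indicator k ν) ≡ k
length-indicator zero    _       = refl
length-indicator (suc k) []      = cong suc (length-indicator k [])
length-indicator (suc k) (v ∷ ν) with v ≟ suc k
... | yes _ = cong suc (length-indicator k ν)
... | no  _ = cong suc (length-indicator k (v ∷ ν))

indicator-top : ∀ k ν → indicator (suc k) (suc k ∷ ν) ≡ true ∷ indicator k ν
indicator-top k ν with suc k ≟ suc k
... | yes _   = refl
... | no  k≢k = contradiction refl k≢k

indicator-below : ∀ k ν → All (_≤ k) ν → indicator (suc k) ν ≡ false ∷ indicator k ν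
indicator-below k []      _         = refl
indicator-below k (v ∷ ν) (v≤k ∷ _) with v ≟ suc k
... | yes refl = contradiction v≤k 1+n≰n
... | no  _    = refl

indicator-subsetOf : ∀ bs → indicator (length bs) (subsetOf bs) ≡ bs
indicator-subsetOf []           = refl
indicator-subsetOf (true  ∷ bs) =
  trans (indicator-top _ _) (cong (true ∷_) (indicator-subsetOf bs))
indicator-subsetOf (false ∷ bs) =
  trans (indicator-below _ _ (subsetOf-≤ bs)) (cong (false ∷_) (indicator-subsetOf bs))

subsetOf-indicator : ∀ k {ν} → AllPairs (λ a b → b < a) ν → All (1 ≤_) ν → All (_≤ k) ν →
                     subsetOf (indicator k ν) ≡ ν
subsetOf-indicator zero    {[]}    _ _ _ = refl
subsetOf-indicator zero    {_ ∷ _} _ (s≤s _ ∷ _) (() ∷ _)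
subsetOf-indicator (suc k) {[]}    _ _ _ = subsetOf-indicator k [] [] []
subsetOf-indicator (suc k) {v ∷ ν} (ν<v ∷ ν↓) 1≤v∷ν@(_ ∷ 1≤ν) (v≤1+k ∷ _) with v ≟ suc k
... | yes refl = cong₂ _∷_ (cong suc (length-indicator k ν))
                           (subsetOf-indicator k ν↓ 1≤ν (All.map ≤-pred ν<v))
... | no  v≢1+k = subsetOf-indicator k (ν<v ∷ ν↓) 1≤v∷ν
                    (v≤k ∷ All.map (λ b<v → ≤-trans (<⇒≤ b<v) v≤k) ν<v)
  where v≤k = ≤-pred (≤∧≢⇒< v≤1+k v≢1+k)

sum-subsetOf-∷ : ∀ b bs → sum (subsetOf (b ∷ bs)) ≡ toℕ b * suc (length bs) + sum (subsetOf bs)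
sum-subsetOf-∷ true  bs = cong (_+ sum (subsetOf bs)) (sym (+-identityʳ (suc (length bs))))
sum-subsetOf-∷ false bs = refl

sum-subsetOf : ∀ bs → sum (subsetOf bs) ≡ weightedSum (map toℕ (reverse bs))
sum-subsetOf []       = refl
sum-subsetOf (b ∷ bs) = begin
  sum (subsetOf (b ∷ bs))
    ≡⟨ sum-subsetOf-∷ b bs ⟩
  toℕ b * suc (length bs) + sum (subsetOf bs)
    ≡⟨ cong₂ (λ l w → toℕ b * suc l + w) (sym length-bits) (sum-subsetOf bs) ⟩
  toℕ b * suc (length (map toℕ (reverse bs))) + weightedSum (map toℕ (reverse bs))
    ≡⟨ sym (weightedSum-∷ʳ (map toℕ (reverse bs)) (toℕ b)) ⟩
  weightedSum (map toℕ (reverse bs) ∷ʳ toℕ b)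
    ≡⟨ cong weightedSum (sym (map-++ toℕ (reverse bs) (b ∷ []))) ⟩
  weightedSum (map toℕ (reverse bs ∷ʳ b))
    ≡⟨ cong (weightedSum ∘ map toℕ) (sym (unfold-reverse b bs)) ⟩
  weightedSum (map toℕ (reverse (b ∷ bs))) ∎
  where
  open ≡-Reasoning
  length-bits : length (map toℕ (reverse bs)) ≡ length bs
  length-bits = trans (length-map toℕ (reverse bs)) (length-reverse bs)

halve : ℕ → ℕ × Bool
halve zero          = 0 , true
halve (suc zero)    = 0 , false
halve (suc (suc n)) = map₁ suc (halve n)

unhalve : ℕ × Bool → ℕ
unhalve (c , even) = toℕ (not even) + 2 * c

unhalve-suc : ∀ c b → unhalve (suc c , b) ≡ 2 + unhalve (c , b)
unhalve-suc c b = lemma (toℕ (not b)) c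
  where
  lemma : ∀ r c → r + 2 * suc c ≡ 2 + (r + 2 * c)
  lemma = solve-∀

unhalve-halve : ∀ n → unhalve (halve n) ≡ n
unhalve-halve zero          = refl
unhalve-halve (suc zero)    = refl
unhalve-halve (suc (suc n)) = trans (unhalve-suc _ _) (cong (2 +_) (unhalve-halve n))

halve-unhalve : ∀ x → halve (unhalve x) ≡ x
halve-unhalve (zero  , true)  = refl
halve-unhalve (zero  , false) = refl
halve-unhalve (suc c , b)     =
  trans (cong halve (unhalve-suc c b)) (cong (map₁ suc) (halve-unhalve (c , b)))

%2-halve : ∀ n → n % 2 ≡ toℕ (not (proj₂ (halve n)))
%2-halve zero          = refl
%2-halve (suc zero)    = refl
%2-halve (suc (suc n)) = %2-halve n

Even : ℕ → Set
Even n = n % 2 ≡ 0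

even⇒2*half : ∀ {e} → Even e → 2 * proj₁ (halve e) ≡ e
even⇒2*half {e} e-even = begin
  2 * c               ≡⟨ cong (_+ 2 * c) (sym remainder≡0) ⟩
  toℕ (not b) + 2 * c ≡⟨ unhalve-halve e ⟩
  e                   ∎
  where
  open ≡-Reasoning
  c = proj₁ (halve e)
  b = proj₂ (halve e)
  remainder≡0 : toℕ (not b) ≡ 0
  remainder≡0 = trans (sym (%2-halve e)) e-even

2*-even : ∀ c → Even (2 * c)
2*-even c = trans (cong (_% 2) (*-comm 2 c)) (m*n%n≡0 c 2)

smallestOdd-gap : ∀ e → (3 + e) % 2 ≡ 1 ⇔ Even e
smallestOdd-gap zero          = mk⇔ (λ _ → refl) (λ _ → refl)
smallestOdd-gap (suc zero)    = mk⇔ (λ ()) (λ ())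
smallestOdd-gap (suc (suc e)) = smallestOdd-gap e

oppositeParity-gap : ∀ t e → OppositeParity (t + (3 + e)) t ⇔ Even e
oppositeParity-gap zero          zero          = mk⇔ (λ _ → refl) (λ _ → refl)
oppositeParity-gap zero          (suc zero)    = mk⇔ (λ ()) (λ ())
oppositeParity-gap zero          (suc (suc e)) = oppositeParity-gap zero e
oppositeParity-gap (suc zero)    zero          = mk⇔ (λ _ → refl) (λ _ → refl)
oppositeParity-gap (suc zero)    (suc zero)    = mk⇔ (λ ()) (λ ())
oppositeParity-gap (suc zero)    (suc (suc e)) = oppositeParity-gap (suc zero) e
oppositeParity-gap (suc (suc t)) e             = oppositeParity-gap t e

-- Partitions whose differences are odd and at least 3

evenGaps⇒alternating : ∀ es → All Even es →
                       Linked OppositeParity (fromGaps 3 es) × SmallestOdd (fromGaps 3 es)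
evenGaps⇒alternating []               _                  = [] , tt
evenGaps⇒alternating (e ∷ [])         (e-even ∷ _)       =
  [-] , Equivalence.from (smallestOdd-gap e) e-even
evenGaps⇒alternating (e ∷ es@(_ ∷ _)) (e-even ∷ es-even) =
  map₁ (Equivalence.from (oppositeParity-gap (largestPart (fromGaps 3 es)) e) e-even ∷_)
       (evenGaps⇒alternating es es-even)

alternating⇒evenGaps : ∀ es → Linked OppositeParity (fromGaps 3 es) → SmallestOdd (fromGaps 3 es) →
                       All Even es
alternating⇒evenGaps []               _            _   = []
alternating⇒evenGaps (e ∷ [])         _            odd = Equivalence.to (smallestOdd-gap e) odd ∷ []
alternating⇒evenGaps (e ∷ es@(_ ∷ _)) (opp ∷ opps) odd =
  Equivalence.to (oppositeParity-gap (largestPart (fromGaps 3 es)) e) opp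
    ∷ alternating⇒evenGaps es opps odd

≥2∧odd⇒≥3 : ∀ {a} → 2 ≤ a → a % 2 ≡ 1 → 3 ≤ a
≥2∧odd⇒≥3 2≤a odd = ≤∧≢⇒< 2≤a λ { refl → 0≢1+n odd }

smallestOdd⇒≥3 : ∀ {π} → All (2 ≤_) π → DifferBy 3 π → SmallestOdd π → All (3 ≤_) π
smallestOdd⇒≥3 {[]}        _           _                   _   = []
smallestOdd⇒≥3 {a ∷ []}    (2≤a ∷ _)   _                   odd = ≥2∧odd⇒≥3 2≤a odd ∷ []
smallestOdd⇒≥3 {a ∷ b ∷ π} (_ ∷ 2≤b∷π) ((b+3≤a ∷ _) ∷ sep) odd =
  m+n≤o⇒n≤o b b+3≤a ∷ smallestOdd⇒≥3 2≤b∷π sep odd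

fromHalfGaps : List ℕ → List ℕ
fromHalfGaps cs = fromGaps 3 (map (2 *_) cs)

toHalfGaps : List ℕ → List ℕ
toHalfGaps π = map (proj₁ ∘ halve) (toGaps 3 π)

length-fromHalfGaps : ∀ cs → length (fromHalfGaps cs) ≡ length cs
length-fromHalfGaps cs = trans (length-fromGaps 3 (map (2 *_) cs)) (length-map (2 *_) cs)

length-toHalfGaps : ∀ π → length (toHalfGaps π) ≡ length π
length-toHalfGaps π = trans (length-map (proj₁ ∘ halve) (toGaps 3 π)) (length-toGaps 3 π)

toHalfGaps-fromHalfGaps : ∀ cs → toHalfGaps (fromHalfGaps cs) ≡ cs
toHalfGaps-fromHalfGaps cs =
  trans (cong (map (proj₁ ∘ halve)) (toGaps-fromGaps 3 (map (2 *_) cs)))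
        (map-inverse (λ c → cong proj₁ (halve-unhalve (c , true))) cs)

fromHalfGaps-toHalfGaps : ∀ {π} → DifferBy 3 π → Linked OppositeParity π → All (2 ≤_) π →
                          SmallestOdd π → fromHalfGaps (toHalfGaps π) ≡ π
fromHalfGaps-toHalfGaps {π} sep opp 2≤π odd = begin
  fromGaps 3 (map (2 *_) (map (proj₁ ∘ halve) es))
    ≡⟨ cong (fromGaps 3) (sym (map-∘ es)) ⟩
  fromGaps 3 (map (λ e → 2 * proj₁ (halve e)) es)
    ≡⟨ cong (fromGaps 3) (map-id-local (All.map even⇒2*half es-even)) ⟩
  fromGaps 3 es
    ≡⟨ fromGaps-es≡π ⟩
  π ∎
  where
  open ≡-Reasoning
  es = toGaps 3 π
  fromGaps-es≡π : fromGaps 3 es ≡ π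
  fromGaps-es≡π = fromGaps-toGaps π (smallestOdd⇒≥3 2≤π sep odd) sep
  es-even : All Even es
  es-even = alternating⇒evenGaps es (subst (Linked OppositeParity) (sym fromGaps-es≡π) opp)
                                    (subst SmallestOdd (sym fromGaps-es≡π) odd)

fromHalfGaps-alternating : ∀ cs →
                           Linked OppositeParity (fromHalfGaps cs) × SmallestOdd (fromHalfGaps cs)
fromHalfGaps-alternating cs =
  evenGaps⇒alternating (map (2 *_) cs) (map⁺ (All.universal 2*-even cs))

-- The i-th entry (cᵢ , bᵢ) of a code gives the i-th gap 2cᵢ + [not bᵢ] of an RR₂ partition,
-- the i-th difference 3 + 2cᵢ of π, and bᵢ = [i ∈ ν].
Code : Set
Code = List (ℕ × Bool)

rr2Partition : Code → List ℕ
rr2Partition xs = fromGaps 2 (map unhalve xs)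

rr2Code : List ℕ → Code
rr2Code p = map halve (toGaps 2 p)

positiveParts : Code → List ℕ
positiveParts xs = fromHalfGaps (map proj₁ xs)

negativeParts : Code → List ℕ
negativeParts xs = subsetOf (reverse (map proj₂ xs))

signedPartition : Code → List ℕ × List ℕ
signedPartition xs = positiveParts xs , negativeParts xs

signedCode : List ℕ × List ℕ → Code
signedCode (π , ν) = zip (toHalfGaps π) (reverse (indicator (length π) ν))

RR2Codes : ℕ → Set
RR2Codes n = Σ Code λ xs → sum (rr2Partition xs) ≡ n

RRm2Codes : ℕ → Set
RRm2Codes n = Σ Code λ xs → sum (positiveParts xs) ≡ n + sum (negativeParts xs)

rr2Partition-rr2Code : ∀ {p} → All (2 ≤_) p → DifferBy 2 p → rr2Partition (rr2Code p) ≡ p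
rr2Partition-rr2Code {p} 2≤p sep =
  trans (cong (fromGaps 2) (map-inverse unhalve-halve (toGaps 2 p))) (fromGaps-toGaps p 2≤p sep)

rr2Code-rr2Partition : ∀ xs → rr2Code (rr2Partition xs) ≡ xs
rr2Code-rr2Partition xs =
  trans (cong (map halve) (toGaps-fromGaps 2 (map unhalve xs))) (map-inverse halve-unhalve xs)

rr2Partition-RR2 : ∀ {n} xs → sum (rr2Partition xs) ≡ n → RR2 n
rr2Partition-RR2 xs sum≡n =
  rr2Partition xs , differBy⇒isPartition (s≤s z≤n) 2≤p sep , sum≡n , 2≤p , sep
  where
  2≤p = fromGaps-≥ 2 (map unhalve xs)
  sep = fromGaps-differBy 2 (map unhalve xs)

signedPartition-signedCode :
  ∀ {π ν} → DifferBy 3 π → Linked OppositeParity π → All (2 ≤_) π → SmallestOdd π →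
  AllPairs (λ a b → b < a) ν → All (1 ≤_) ν → All (_≤ length π) ν →
  signedPartition (signedCode (π , ν)) ≡ (π , ν)
signedPartition-signedCode {π} {ν} sep opp 2≤π odd ν↓ 1≤ν ν≤k = begin
  signedPartition (zip cs bs)
    ≡⟨ cong (λ (cs′ , bs′) → fromHalfGaps cs′ , subsetOf (reverse bs′))
            (map-proj-zip cs bs same-length) ⟩
  fromHalfGaps cs , subsetOf (reverse bs)
    ≡⟨ cong₂ _,_ (fromHalfGaps-toHalfGaps sep opp 2≤π odd)
                 (trans (cong subsetOf (reverse-involutive bits))
                        (subsetOf-indicator (length π) ν↓ 1≤ν ν≤k)) ⟩
  π , ν ∎
  where
  open ≡-Reasoning
  bits = indicator (length π) ν
  cs = toHalfGaps π
  bs = reverse bits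
  same-length : length cs ≡ length bs
  same-length = trans (length-toHalfGaps π)
                      (sym (trans (length-reverse bits) (length-indicator (length π) ν)))

signedCode-signedPartition : ∀ xs → signedCode (signedPartition xs) ≡ xs
signedCode-signedPartition xs = begin
  zip (toHalfGaps (fromHalfGaps cs))
      (reverse (indicator (length (fromHalfGaps cs)) (subsetOf (reverse bs))))
    ≡⟨ cong₂ zip (toHalfGaps-fromHalfGaps cs)
                 (cong reverse (trans (cong (λ k → indicator k (subsetOf (reverse bs))) same-length)
                                      (indicator-subsetOf (reverse bs)))) ⟩
  zip cs (reverse (reverse bs))
    ≡⟨ cong (zip cs) (reverse-involutive bs) ⟩
  zip cs bs
    ≡⟨ zip-map-proj xs ⟩
  xs ∎
  where
  open ≡-Reasoning
  cs = map proj₁ xs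
  bs = map proj₂ xs
  same-length : length (fromHalfGaps cs) ≡ length (reverse bs)
  same-length = trans (length-fromHalfGaps cs)
                      (trans (length-map proj₁ xs)
                             (sym (trans (length-reverse bs) (length-map proj₂ xs))))

signedPartition-RRm2 : ∀ {n} xs → sum (positiveParts xs) ≡ n + sum (negativeParts xs) → RRm2 n
signedPartition-RRm2 xs π≡n+ν =
  signedPartition xs ,
  differBy⇒isPartition (s≤s z≤n) 3≤π sep ,
  (subsetOf-positive bs , Linked.map <⇒≤ (AllPairs⇒Linked (subsetOf-decreasing bs))) ,
  π≡n+ν , sep , proj₁ alternating , All.map (≤-trans (n≤1+n 2)) 3≤π , proj₂ alternating ,
  subsetOf-decreasing bs , subst (λ k → All (_≤ k) (subsetOf bs)) same-length (subsetOf-≤ bs)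
  where
  cs = map proj₁ xs
  bs = reverse (map proj₂ xs)
  3≤π = fromGaps-≥ 3 (map (2 *_) cs)
  sep = fromGaps-differBy 3 (map (2 *_) cs)
  alternating = fromHalfGaps-alternating cs
  same-length : length bs ≡ length (positiveParts xs)
  same-length = trans (length-reverse (map proj₂ xs))
                      (trans (length-map proj₂ xs)
                             (sym (trans (length-fromHalfGaps cs) (length-map proj₁ xs))))

gap-identity : ∀ x → toℕ (proj₂ x) + (2 + unhalve x) ≡ 3 + 2 * proj₁ x
gap-identity (c , true)  = refl
gap-identity (c , false) = refl

weight-identity : ∀ xs → sum (negativeParts xs) + sum (rr2Partition xs) ≡ sum (positiveParts xs)
weight-identity xs = begin
  sum (negativeParts xs) + sum (rr2Partition xs)
    ≡⟨ cong₂ _+_ (sum-subsetOf (reverse bs)) (sum-fromGaps 2 (map unhalve xs)) ⟩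
  weightedSum (map toℕ (reverse (reverse bs))) + weightedSum (map (2 +_) (map unhalve xs))
    ≡⟨ cong₂ _+_ (trans (cong (weightedSum ∘ map toℕ) (reverse-involutive bs))
                        (cong weightedSum (sym (map-∘ xs))))
                 (cong weightedSum (sym (map-∘ xs))) ⟩
  weightedSum (map (toℕ ∘ proj₂) xs) + weightedSum (map ((2 +_) ∘ unhalve) xs)
    ≡⟨ weightedSum-map-+ gap-identity xs ⟩
  weightedSum (map ((3 +_) ∘ (2 *_) ∘ proj₁) xs)
    ≡⟨ cong weightedSum (trans (map-∘ xs) (cong (map (3 +_)) (map-∘ xs))) ⟩
  weightedSum (map (3 +_) (map (2 *_) (map proj₁ xs)))
    ≡⟨ sym (sum-fromGaps 3 (map (2 *_) (map proj₁ xs))) ⟩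
  sum (positiveParts xs) ∎
  where
  open ≡-Reasoning
  bs = map proj₂ xs

RR2↔RR2Codes : ∀ n → RR2 n ↔ RR2Codes n
RR2↔RR2Codes n = mk↔-subset
  (isPartition-irrelevant ×-irrelevant ≡-irrelevant ×-irrelevant
   All.irrelevant ≤-irrelevant ×-irrelevant differBy-irrelevant)
  ≡-irrelevant
  rr2Code rr2Partition
  (λ (_ , sum≡n , 2≤p , sep) → trans (cong sum (rr2Partition-rr2Code 2≤p sep)) sum≡n)
  (λ {xs} sum≡n → proj₂ (rr2Partition-RR2 xs sum≡n))
  (λ (_ , _ , 2≤p , sep) → rr2Partition-rr2Code 2≤p sep)
  (λ {xs} _ → rr2Code-rr2Partition xs)

RR2Codes↔RRm2Codes : ∀ n → RR2Codes n ↔ RRm2Codes n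
RR2Codes↔RRm2Codes n = mk↔-subset ≡-irrelevant ≡-irrelevant id id
  (λ {xs} rr≡n → trans (sym (weight-identity xs))
                       (trans (+-comm (sum (negativeParts xs)) _)
                              (cong (_+ sum (negativeParts xs)) rr≡n)))
  (λ {xs} π≡n+ν → +-cancelˡ-≡ (sum (negativeParts xs)) _ _
                    (trans (weight-identity xs) (trans π≡n+ν (+-comm n _))))
  (λ _ → refl)
  (λ _ → refl)

RRm2↔RRm2Codes : ∀ n → RRm2 n ↔ RRm2Codes n
RRm2↔RRm2Codes n = mk↔-subset
  (λ {(π , _)} →
    isPartition-irrelevant ×-irrelevant isPartition-irrelevant ×-irrelevant ≡-irrelevant
    ×-irrelevant differBy-irrelevant ×-irrelevant Linked.irrelevant ≡-irrelevant
    ×-irrelevant All.irrelevant ≤-irrelevant ×-irrelevant smallestOdd-irrelevant π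
    ×-irrelevant AllPairs.irrelevant <-irrelevant ×-irrelevant All.irrelevant ≤-irrelevant)
  ≡-irrelevant
  signedCode signedPartition
  (λ (_ , (1≤ν , _) , π≡n+ν , sep , opp , 2≤π , odd , ν↓ , ν≤k) →
    subst (λ (π′ , ν′) → sum π′ ≡ n + sum ν′)
          (sym (signedPartition-signedCode sep opp 2≤π odd ν↓ 1≤ν ν≤k)) π≡n+ν)
  (λ {xs} π≡n+ν → proj₂ (signedPartition-RRm2 xs π≡n+ν))
  (λ (_ , (1≤ν , _) , _ , sep , opp , 2≤π , odd , ν↓ , ν≤k) →
    signedPartition-signedCode sep opp 2≤π odd ν↓ 1≤ν ν≤k)
  (λ {xs} _ → signedCode-signedPartition xs)

theorem3p2 : (n : ℕ) → RR2 n ↔ RRm2 n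
theorem3p2 n =
  ↔-trans (RR2↔RR2Codes n) (↔-trans (RR2Codes↔RRm2Codes n) (↔-sym (RRm2↔RRm2Codes n)))
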